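{- Any streaming certification scheme for $\mathrm{Degeneracy}_{\leq 1}$ whose verifier uses $m$ bits of memory and whose certificates have $c$ bits satisfies $c+m=\Omega(n)$ on $n$-node graphs.
   Context: A graph is $k$-degenerate if every subgraph has a vertex of degree at most $k$; the degeneracy of $G$ is the smallest such $k$. $\mathrm{Degeneracy}_{\leq 1}$ is the decision problem (with fixed threshold $1$) taking as input a graph $G$ and asking whether its degeneracy is at most $1$. The $n$-node input graph on $[n]$ is given as a stream of edges in an arbitrary, possibly adversarial, order. A streaming certification scheme for a decision problem $P$ consists of a prover (a computationally unlimited function producing a certificate in $\{0,1\}^*$ depending only on the input graph, not on the edge order) and a verifier (a deterministic streaming algorithm with read-only access to the certificate that processes the stream and outputs accept or reject). Completeness: if $G$ satisfies $P$, some certificate makes the verifier accept for every edge order. Soundness: if $G$ does not satisfy $P$, the verifier rejects for every certificate and every edge order. $c$ is the certificate length and $m$ the verifier's memory excluding the certificate, as worst-case functions of $n$. -}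

module Defs where

open import Data.Nat using (ℕ; zero; suc; _+_; _*_; _≤_; _<_)
open import Data.Bool using (Bool; true; false; if_then_else_)
open import Data.Fin using (Fin; toℕ)
open import Data.Fin.Properties using () renaming (_≟_ to _≟F_)
open import Data.List using (List; []; _∷_; length; map; foldl; allFin)
open import Data.Nat.ListAction using (sum)
open import Data.List.Relation.Unary.All using (All)
open import Data.Vec using (Vec)
open import Data.Product using (_×_; _,_; ∃; Σ)
open import Relation.Binary.PropositionalEquality using (_≡_)
open import Relation.Nullary using (¬_; yes; no)

record Graph (n : ℕ) : Set where
  field
    adj     : Fin n → Fin n → Bool
    sym     : ∀ u v → adj u v ≡ adj v u
    irrefl  : ∀ u → adj u u ≡ false
open Graph public

record Subgraph {n : ℕ} (G : Graph n) : Set where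
  field
    vert    : Fin n → Bool
    hadj    : Fin n → Fin n → Bool
    hsym    : ∀ u v → hadj u v ≡ hadj v u
    hsub    : ∀ u v → hadj u v ≡ true → adj G u v ≡ true
    hclosed : ∀ u v → hadj u v ≡ true → vert u ≡ true
open Subgraph public

degree : ∀ {n} {G : Graph n} → Subgraph G → Fin n → ℕ
degree {n} H v = sum (map (λ w → if hadj H v w then 1 else 0) (allFin n))

Degenerate : ℕ → ∀ {n} → Graph n → Set
Degenerate k G = ∀ (H : Subgraph G) → ∃ (λ v → vert H v ≡ true) →
                 ∃ (λ v → vert H v ≡ true × degree H v ≤ k)

Degeneracy≤1 : ∀ {n} → Graph n → Set
Degeneracy≤1 G = Degenerate 1 G

occ : ∀ {n} → Fin n → Fin n → List (Fin n × Fin n) → ℕ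
occ u v [] = 0
occ u v ((a , b) ∷ s) with a ≟F u | b ≟F v | a ≟F v | b ≟F u
... | yes _ | yes _ | _     | _     = suc (occ u v s)
... | _     | _     | yes _ | yes _ = suc (occ u v s)
... | _     | _     | _     | _     = occ u v s

-- s is an edge stream of G: every item is an edge of G, and every edge of
-- G appears exactly once (in either orientation), in arbitrary order.
IsStream : ∀ {n} → Graph n → List (Fin n × Fin n) → Set
IsStream {n} G s =
  All (λ e → adj G (Data.Product.proj₁ e) (Data.Product.proj₂ e) ≡ true) s ×
  (∀ (u v : Fin n) → toℕ u < toℕ v → adj G u v ≡ true → occ u v s ≡ 1)

Certificate : Set
Certificate = List Bool

-- The verifier is a deterministic streaming algorithm whose
-- memory is a state in {0,1}^m; it has read-only access to the certificate
-- (so its initial state, transitions and final decision may depend on it).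
record Scheme (n c m : ℕ) : Set where
  field
    prover    : Graph n → Certificate
    proverLen : ∀ G → length (prover G) ≤ c
    init      : Certificate → Vec Bool m
    step      : Certificate → Vec Bool m → Fin n × Fin n → Vec Bool m
    decide    : Certificate → Vec Bool m → Bool

  run : Certificate → List (Fin n × Fin n) → Bool
  run cert s = decide cert (foldl (step cert) (init cert) s)

  field
    completeness : ∀ (G : Graph n) → Degeneracy≤1 G →
                   ∀ s → IsStream G s → run (prover G) s ≡ true
    soundness    : ∀ (G : Graph n) → ¬ Degeneracy≤1 G →
                   ∀ (cert : Certificate) s → IsStream G s → run cert s ≡ false
open Scheme public

-- Cut the vertices into k = ⌊n/4⌋ gadgets of four vertices, each carrying two perfect matchings,
-- a "column" and a "row" matching, whose union is a 4-cycle. For bit strings S, T ∈ {0,1}^k let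
-- G(S,T) contain the column matching of gadget i when Sᵢ = 1 and its row matching when Tᵢ = 0,
-- streamed as the column edges (which depend on S only) followed by the row edges (which depend
-- on T only). Every G(S,S) is a matching, hence 1-degenerate, while Sᵢ = 1 and Tᵢ = 0 make gadget i
-- of G(S,T) a 4-cycle, a subgraph of minimum degree 2. So the certificate of G(S,S) together with
-- the verifier's memory after the column edges of S determines S: if both agreed for S and T with
-- Sᵢ = 1 and Tᵢ = 0, the verifier would run on G(S,T) exactly as on G(T,T) and accept it.
-- Counting then gives k ≤ (c + 1) + m, since certificates of at most c bits pad injectively to c + 1 bits.
module Submission where

open import Defs
open import Data.Nat using (ℕ; _+_; _*_; _≤_)
open import Data.Product using (Σ; ∃)

open import Data.Bool using (Bool; true; false; _∧_; _∨_; not; if_then_else_)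
import Data.Bool.Properties as Bool
open import Data.Empty using (⊥; ⊥-elim)
open import Data.Fin using (Fin; zero; suc; toℕ; fromℕ<; combine; remQuot)
import Data.Fin.Properties as Fin
open import Data.Fin.Patterns using (0F; 1F; 2F; 3F)
open import Data.List
  using (List; []; _∷_; _++_; length; map; foldl; allFin; tabulate; filter; cartesianProduct)
import Data.List.Properties as List
open import Data.List.Membership.Propositional using (_∈_; _∉_)
open import Data.List.Membership.Propositional.Properties
  using (∈-filter⁺; ∈-allFin; ∈-cartesianProduct⁺; ∈-++⁺ˡ; ∈-++⁺ʳ)
open import Data.List.Relation.Unary.All as All using (All; []; _∷_)
open import Data.List.Relation.Unary.All.Properties using (all-filter; ++⁺)
open import Data.List.Relation.Unary.Any using (here; there)
open import Data.List.Relation.Unary.Unique.Propositional using (Unique; _∷_)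
import Data.List.Relation.Unary.Unique.Propositional.Properties as Unique
open import Data.Nat using (zero; suc; _<_; _^_; _≟_; z≤n; s≤s; z<s; s<s)
import Data.Nat.Properties as ℕ
open import Data.Nat.ListAction using (sum)
open import Data.Product using (_×_; _,_; proj₁; proj₂; map₁; ∃₂)
open import Data.Sum using (_⊎_; inj₁; inj₂)
open import Data.Vec using (Vec; []; _∷_; replicate)
import Data.Vec as Vec
import Data.Vec.Properties as Vec
open import Function using (_∘_; id; Injective; Inverse)
open import Function.Bundles using (mk⇔)
open import Relation.Binary.PropositionalEquality hiding (sym)
import Relation.Binary.PropositionalEquality as ≡
open import Relation.Nullary using (¬_; Dec; yes; no; does; contradiction)
open import Relation.Nullary.Decidable using (_×-dec_; dec-true; dec-false; does-⇔)
open import Relation.Unary using (Decidable)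
open import Algebra.Definitions {A = Fin 4} _≡_ using (Involutive)

does⇒ : ∀ {A : Set} (a? : Dec A) → does a? ≡ true → A
does⇒ (yes a) _ = a

∨-true : ∀ {x y} → x ∨ y ≡ true → x ≡ true ⊎ y ≡ true
∨-true {true}  _ = inj₁ refl
∨-true {false} e = inj₂ e

-- Bit strings

module Bit = Inverse Fin.2↔Bool

toFin : ∀ {k} → Vec Bool k → Fin (2 ^ k)
toFin []      = zero
toFin (b ∷ v) = combine (Bit.from b) (toFin v)

fromFin : ∀ k → Fin (2 ^ k) → Vec Bool k
fromFin zero    _ = []
fromFin (suc k) i = Bit.to (proj₁ (remQuot {2} (2 ^ k) i)) ∷ fromFin k (proj₂ (remQuot {2} (2 ^ k) i))

fromFin-toFin : ∀ {k} (v : Vec Bool k) → fromFin k (toFin v) ≡ v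
fromFin-toFin []              = refl
fromFin-toFin {suc k} (b ∷ v) = cong₂ _∷_
  (trans (cong (Bit.to ∘ proj₁) split) (Bit.strictlyInverseˡ b))
  (trans (cong (fromFin k ∘ proj₂) split) (fromFin-toFin v))
  where split = Fin.remQuot-combine {2} {2 ^ k} (Bit.from b) (toFin v)

toFin-fromFin : ∀ k (i : Fin (2 ^ k)) → toFin (fromFin k i) ≡ i
toFin-fromFin zero    zero = refl
toFin-fromFin (suc k) i    = begin
  combine (Bit.from (Bit.to q)) (toFin (fromFin k r))
    ≡⟨ cong₂ combine (Bit.strictlyInverseʳ q) (toFin-fromFin k r) ⟩
  combine q r
    ≡⟨ Fin.combine-remQuot {2} (2 ^ k) i ⟩
  i ∎
  where
  open ≡-Reasoning
  q = proj₁ (remQuot {2} (2 ^ k) i)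
  r = proj₂ (remQuot {2} (2 ^ k) i)

toFin-injective : ∀ {k} → Injective _≡_ _≡_ (toFin {k})
toFin-injective {k} {u} {v} e =
  trans (≡.sym (fromFin-toFin u)) (trans (cong (fromFin k) e) (fromFin-toFin v))

fromFin-injective : ∀ k → Injective _≡_ _≡_ (fromFin k)
fromFin-injective k {i} {j} e =
  trans (≡.sym (toFin-fromFin k i)) (trans (cong toFin e) (toFin-fromFin k j))

bitVector-pigeonhole : ∀ {k j} (f : Vec Bool k → Vec Bool j) → Injective _≡_ _≡_ f → k ≤ j
bitVector-pigeonhole {k} f f-inj = ℕ.≮⇒≥ λ j<k →
  ℕ.<⇒≱ (ℕ.^-monoʳ-< 2 (s≤s (s≤s z≤n)) j<k)
        (Fin.injective⇒≤ {f = toFin ∘ f ∘ fromFin k}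
                         (fromFin-injective k ∘ f-inj ∘ toFin-injective))

-- The `true` right after the list marks where it ends.
padWithSentinel : ∀ c → List Bool → Vec Bool (suc c)
padWithSentinel zero    _       = true ∷ []
padWithSentinel (suc c) []      = true ∷ replicate (suc c) false
padWithSentinel (suc c) (b ∷ l) = b ∷ padWithSentinel c l

padWithSentinel-≢-falses : ∀ c l → padWithSentinel c l ≢ replicate (suc c) false
padWithSentinel-≢-falses zero    _       ()
padWithSentinel-≢-falses (suc c) []      ()
padWithSentinel-≢-falses (suc c) (b ∷ l) e = padWithSentinel-≢-falses c l (Vec.∷-injectiveʳ e)

padWithSentinel-injective : ∀ c {l₁ l₂ : List Bool} → length l₁ ≤ c → length l₂ ≤ c →
                            padWithSentinel c l₁ ≡ padWithSentinel c l₂ → l₁ ≡ l₂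
padWithSentinel-injective zero    {[]}     {[]}     _       _       _ = refl
padWithSentinel-injective (suc c) {[]}     {[]}     _       _       _ = refl
padWithSentinel-injective (suc c) {[]}     {b ∷ l}  _       _       e =
  ⊥-elim (padWithSentinel-≢-falses c l (≡.sym (Vec.∷-injectiveʳ e)))
padWithSentinel-injective (suc c) {b ∷ l}  {[]}     _       _       e =
  ⊥-elim (padWithSentinel-≢-falses c l (Vec.∷-injectiveʳ e))
padWithSentinel-injective (suc c) {a ∷ l₁} {b ∷ l₂} (s≤s p) (s≤s q) e =
  cong₂ _∷_ (Vec.∷-injectiveˡ e) (padWithSentinel-injective c p q (Vec.∷-injectiveʳ e))

bitAt : ∀ {k} → Vec Bool k → ℕ → Bool
bitAt []      _       = false
bitAt (b ∷ _) zero    = b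
bitAt (_ ∷ v) (suc i) = bitAt v i

bitAt-true⇒< : ∀ {k} (v : Vec Bool k) {i} → bitAt v i ≡ true → i < k
bitAt-true⇒< (_ ∷ _) {zero}  _ = z<s
bitAt-true⇒< (_ ∷ v) {suc i} e = s<s (bitAt-true⇒< v e)

bitAt-injective : ∀ {k} {u v : Vec Bool k} → (∀ i → bitAt u i ≡ bitAt v i) → u ≡ v
bitAt-injective {u = []}    {[]}    _  = refl
bitAt-injective {u = a ∷ u} {b ∷ v} eq = cong₂ _∷_ (eq zero) (bitAt-injective (eq ∘ suc))

-- Degrees

count : ∀ {n} → (Fin n → Bool) → ℕ
count {n} p = sum (map (λ w → if p w then 1 else 0) (allFin n))

count-suc : ∀ {n} (p : Fin (suc n) → Bool) →
            count p ≡ (if p zero then 1 else 0) + count (p ∘ suc)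
count-suc {n} p = cong (λ xs → f zero + sum xs) (begin
  map f (tabulate suc)     ≡⟨ List.map-tabulate suc f ⟩
  tabulate (f ∘ suc)       ≡⟨ List.map-tabulate id (f ∘ suc) ⟨
  map (f ∘ suc) (allFin n) ∎)
  where
  open ≡-Reasoning
  f = λ w → if p w then 1 else 0

count-none : ∀ {n} (p : Fin n → Bool) → (∀ w → p w ≡ false) → count p ≡ 0
count-none {zero}  p none = refl
count-none {suc n} p none rewrite count-suc p | none zero = count-none (p ∘ suc) (none ∘ suc)

count-≥1 : ∀ {n} (p : Fin n → Bool) {a} → p a ≡ true → 1 ≤ count p
count-≥1 p {zero}  pa rewrite count-suc p | pa = s≤s z≤n
count-≥1 p {suc a} pa rewrite count-suc p = ℕ.≤-trans (count-≥1 (p ∘ suc) pa) (ℕ.m≤n+m _ _)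

count-≤1 : ∀ {n} (p : Fin n → Bool) → (∀ a b → p a ≡ true → p b ≡ true → a ≡ b) → count p ≤ 1
count-≤1 {zero}  p unique = z≤n
count-≤1 {suc n} p unique rewrite count-suc p with p zero in p0
... | false = count-≤1 (p ∘ suc) (λ a b pa pb → Fin.suc-injective (unique _ _ pa pb))
... | true  = ℕ.≤-reflexive (cong suc (count-none (p ∘ suc) rest))
  where
  rest : ∀ w → p (suc w) ≡ false
  rest w with p (suc w) in pw
  ... | false = refl
  ... | true  with () ← unique _ _ p0 pw

count-≥2 : ∀ {n} (p : Fin n → Bool) {a b} → a ≢ b → p a ≡ true → p b ≡ true → 2 ≤ count p
count-≥2 p {zero}  {zero}  a≢b _  _  = ⊥-elim (a≢b refl)
count-≥2 p {zero}  {suc b} _   pa pb rewrite count-suc p | pa = s≤s (count-≥1 (p ∘ suc) pb)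
count-≥2 p {suc a} {zero}  _   pa pb rewrite count-suc p | pb = s≤s (count-≥1 (p ∘ suc) pa)
count-≥2 p {suc a} {suc b} a≢b pa pb rewrite count-suc p =
  ℕ.≤-trans (count-≥2 (p ∘ suc) (a≢b ∘ cong suc) pa pb) (ℕ.m≤n+m _ _)

induced : ∀ {n} (G : Graph n) → (Fin n → Bool) → Subgraph G
induced G C = record
  { vert    = C
  ; hadj    = λ u v → adj G u v ∧ (C u ∧ C v)
  ; hsym    = λ u v → cong₂ _∧_ (Graph.sym G u v) (Bool.∧-comm (C u) (C v))
  ; hsub    = λ u v → Bool.∧-conicalˡ _ _
  ; hclosed = λ u v → Bool.∧-conicalˡ (C u) (C v) ∘ Bool.∧-conicalʳ (adj G u v) _
  }

atMostOneNeighbour⇒Degeneracy≤1 : ∀ {n} (G : Graph n) →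
  (∀ v w₁ w₂ → adj G v w₁ ≡ true → adj G v w₂ ≡ true → w₁ ≡ w₂) → Degeneracy≤1 G
atMostOneNeighbour⇒Degeneracy≤1 G functional H (v , v∈H) = v , v∈H ,
  count-≤1 (hadj H v) λ w₁ w₂ e₁ e₂ → functional v w₁ w₂ (hsub H v w₁ e₁) (hsub H v w₂ e₂)

TwoNeighboursIn : ∀ {n} → Graph n → (Fin n → Bool) → Fin n → Set
TwoNeighboursIn G C v = ∃₂ λ w₁ w₂ → w₁ ≢ w₂ ×
  (C w₁ ≡ true × adj G v w₁ ≡ true) × (C w₂ ≡ true × adj G v w₂ ≡ true)

minDegree≥2⇒¬Degeneracy≤1 : ∀ {n} (G : Graph n) (C : Fin n → Bool) → ∃ (λ v → C v ≡ true) →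
  (∀ v → C v ≡ true → TwoNeighboursIn G C v) → ¬ Degeneracy≤1 G
minDegree≥2⇒¬Degeneracy≤1 G C nonempty twoNeighbours degenerate
  with v , v∈C , deg≤1 ← degenerate (induced G C) nonempty
  with w₁ , w₂ , w₁≢w₂ , (w₁∈C , vw₁) , (w₂∈C , vw₂) ← twoNeighbours v v∈C
  = ℕ.<⇒≱ (s≤s (s≤s z≤n))
          (ℕ.≤-trans (count-≥2 _ w₁≢w₂ (edge vw₁ w₁∈C) (edge vw₂ w₂∈C)) deg≤1)
  where
  edge : ∀ {w} → adj G v w ≡ true → C w ≡ true → adj G v w ∧ (C v ∧ C w) ≡ true
  edge vw w∈C rewrite vw | v∈C | w∈C = refl

-- Edge streams

occ-hit : ∀ {n} (u v : Fin n) s → occ u v ((u , v) ∷ s) ≡ suc (occ u v s)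
occ-hit u v s with u Fin.≟ u | v Fin.≟ v | u Fin.≟ v | v Fin.≟ u
... | yes _ | yes _ | _ | _ = refl
... | no ≢u | _     | _ | _ = ⊥-elim (≢u refl)
... | yes _ | no ≢v | _ | _ = ⊥-elim (≢v refl)

occ-miss : ∀ {n} {u v a b : Fin n} s → ¬ (a ≡ u × b ≡ v) → ¬ (a ≡ v × b ≡ u) →
           occ u v ((a , b) ∷ s) ≡ occ u v s
occ-miss {u = u} {v} {a} {b} s ¬uv ¬vu with a Fin.≟ u | b Fin.≟ v | a Fin.≟ v | b Fin.≟ u
... | yes p | yes q | _     | _     = ⊥-elim (¬uv (p , q))
... | yes _ | no _  | yes p | yes q = ⊥-elim (¬vu (p , q))
... | yes _ | no _  | yes _ | no _  = refl
... | yes _ | no _  | no _  | _     = refl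
... | no _  | _     | yes p | yes q = ⊥-elim (¬vu (p , q))
... | no _  | _     | yes _ | no _  = refl
... | no _  | _     | no _  | _     = refl

OrderedEdge : ∀ {n} → (Fin n → Fin n → Bool) → Fin n × Fin n → Set
OrderedEdge R (a , b) = toℕ a < toℕ b × R a b ≡ true

module _ {n} {R : Fin n → Fin n → Bool} {u v : Fin n} (u<v : toℕ u < toℕ v) where

  private
    not-reversed : ∀ {a b} → OrderedEdge R (a , b) → ¬ (a ≡ v × b ≡ u)
    not-reversed (a<b , _) (refl , refl) = ℕ.<-asym u<v a<b

  occ-∉ : ∀ {xs} → All (OrderedEdge R) xs → (u , v) ∉ xs → occ u v xs ≡ 0
  occ-∉ []          _   = refl
  occ-∉ (ab ∷ rest) uv∉ =
    trans (occ-miss _ (λ { (refl , refl) → uv∉ (here refl) }) (not-reversed ab))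
          (occ-∉ rest (uv∉ ∘ there))

  occ-∈ : ∀ {xs} → Unique xs → All (OrderedEdge R) xs → (u , v) ∈ xs → occ u v xs ≡ 1
  occ-∈ (fresh ∷ _)      (_ ∷ rest)  (here refl) =
    trans (occ-hit u v _) (cong suc (occ-∉ rest (λ uv∈ → All.lookup fresh uv∈ refl)))
  occ-∈ (fresh ∷ unique) (ab ∷ rest) (there uv∈) =
    trans (occ-miss _ (λ { (refl , refl) → All.lookup fresh uv∈ refl }) (not-reversed ab))
          (occ-∈ unique rest uv∈)

orderedEdgeList⇒IsStream : ∀ {n} (G : Graph n) {xs} → Unique xs → All (OrderedEdge (adj G)) xs →
  (∀ u v → toℕ u < toℕ v → adj G u v ≡ true → (u , v) ∈ xs) → IsStream G xs
orderedEdgeList⇒IsStream G unique edges complete =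
  All.map proj₂ edges , λ u v u<v uv → occ-∈ u<v unique edges (complete u v u<v uv)

orderedEdge? : ∀ {n} (R : Fin n → Fin n → Bool) → Decidable (OrderedEdge R)
orderedEdge? R (a , b) = toℕ a ℕ.<? toℕ b ×-dec R a b Bool.≟ true

edgeList : ∀ {n} → (Fin n → Fin n → Bool) → List (Fin n × Fin n)
edgeList {n} R = filter (orderedEdge? R) (cartesianProduct (allFin n) (allFin n))

edgeList-unique : ∀ {n} (R : Fin n → Fin n → Bool) → Unique (edgeList R)
edgeList-unique {n} R = Unique.filter⁺ (orderedEdge? R)
  (Unique.cartesianProduct⁺ (Unique.allFin⁺ n) (Unique.allFin⁺ n))

edgeList-ordered : ∀ {n} (R : Fin n → Fin n → Bool) → All (OrderedEdge R) (edgeList R)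
edgeList-ordered {n} R = all-filter (orderedEdge? R) (cartesianProduct (allFin n) (allFin n))

∈-edgeList : ∀ {n} {R : Fin n → Fin n → Bool} {u v} → toℕ u < toℕ v → R u v ≡ true →
             (u , v) ∈ edgeList R
∈-edgeList {R = R} u<v uv =
  ∈-filter⁺ (orderedEdge? R) (∈-cartesianProduct⁺ (∈-allFin _) (∈-allFin _)) (u<v , uv)

edgeList-++-IsStream : ∀ {n} (G : Graph n) (P Q : Fin n → Fin n → Bool) →
  (∀ u v → adj G u v ≡ P u v ∨ Q u v) → (∀ u v → P u v ≡ true → Q u v ≡ true → ⊥) →
  IsStream G (edgeList P ++ edgeList Q)
edgeList-++-IsStream G P Q adj≡P∨Q disjoint = orderedEdgeList⇒IsStream G
  (Unique.++⁺ (edgeList-unique P) (edgeList-unique Q) λ (e∈P , e∈Q) →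
     disjoint _ _ (proj₂ (All.lookup (edgeList-ordered P) e∈P))
                  (proj₂ (All.lookup (edgeList-ordered Q) e∈Q)))
  (++⁺ (All.map (λ (u<v , uv) → u<v , fromP uv) (edgeList-ordered P))
       (All.map (λ (u<v , uv) → u<v , fromQ uv) (edgeList-ordered Q)))
  complete
  where
  fromP : ∀ {u v} → P u v ≡ true → adj G u v ≡ true
  fromP uv = trans (adj≡P∨Q _ _) (cong (_∨ _) uv)
  fromQ : ∀ {u v} → Q u v ≡ true → adj G u v ≡ true
  fromQ uv = trans (adj≡P∨Q _ _) (trans (cong (_ ∨_) uv) (Bool.∨-zeroʳ _))
  complete : ∀ u v → toℕ u < toℕ v → adj G u v ≡ true → (u , v) ∈ edgeList P ++ edgeList Q
  complete u v u<v uv with P u v in p | Q u v in q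
  ... | true  | _     = ∈-++⁺ˡ (∈-edgeList u<v p)
  ... | false | true  = ∈-++⁺ʳ (edgeList P) (∈-edgeList u<v q)
  ... | false | false with () ← trans (≡.sym uv) (trans (adj≡P∨Q u v) (cong₂ _∨_ p q))

-- Gadgets

split : ℕ → ℕ × Fin 4
split 0 = 0 , 0F
split 1 = 0 , 1F
split 2 = 0 , 2F
split 3 = 0 , 3F
split (suc (suc (suc (suc x)))) = map₁ suc (split x)

join : ℕ × Fin 4 → ℕ
join (i , r) = i * 4 + toℕ r

join-split : ∀ x → join (split x) ≡ x
join-split 0 = refl
join-split 1 = refl
join-split 2 = refl
join-split 3 = refl
join-split (suc (suc (suc (suc x)))) = cong (4 +_) (join-split x)

split-join : ∀ p → split (join p) ≡ p
split-join (zero  , 0F) = refl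
split-join (zero  , 1F) = refl
split-join (zero  , 2F) = refl
split-join (zero  , 3F) = refl
split-join (suc i , r)  = cong (map₁ suc) (split-join (i , r))

join-< : ∀ {i k} (r : Fin 4) → i < k → join (i , r) < k * 4
join-< {i} {k} r i<k = ℕ.<-≤-trans (ℕ.+-monoʳ-< (i * 4) (Fin.toℕ<n r))
  (ℕ.≤-trans (ℕ.≤-reflexive (ℕ.+-comm (i * 4) 4)) (ℕ.*-monoˡ-≤ 4 i<k))

gadget : ℕ → ℕ
gadget = proj₁ ∘ split

role : ℕ → Fin 4
role = proj₂ ∘ split

gadget<⇒< : ∀ {k} x → gadget x < k → x < k * 4
gadget<⇒< x g<k = subst (_< _) (join-split x) (join-< (role x) g<k)

partner : (Fin 4 → Fin 4) → ℕ → ℕ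
partner σ x = join (gadget x , σ (role x))

module _ (σ : Fin 4 → Fin 4) (x : ℕ) where

  gadget-partner : gadget (partner σ x) ≡ gadget x
  gadget-partner = cong proj₁ (split-join (gadget x , σ (role x)))

  role-partner : role (partner σ x) ≡ σ (role x)
  role-partner = cong proj₂ (split-join (gadget x , σ (role x)))

partner-involutive : ∀ {σ} → Involutive σ → ∀ x → partner σ (partner σ x) ≡ x
partner-involutive {σ} σ-inv x = begin
  join (gadget (partner σ x) , σ (role (partner σ x)))
    ≡⟨ cong₂ (λ i r → join (i , σ r)) (gadget-partner σ x) (role-partner σ x) ⟩
  join (gadget x , σ (σ (role x)))
    ≡⟨ cong (λ r → join (gadget x , r)) (σ-inv (role x)) ⟩
  join (split x)
    ≡⟨ join-split x ⟩
  x ∎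
  where open ≡-Reasoning

partner-≢ : ∀ {σ τ} → (∀ r → σ r ≢ τ r) → ∀ x → partner σ x ≢ partner τ x
partner-≢ {σ} {τ} σ≢τ x e = σ≢τ (role x) (begin
  σ (role x)         ≡⟨ role-partner σ x ⟨
  role (partner σ x) ≡⟨ cong role e ⟩
  role (partner τ x) ≡⟨ role-partner τ x ⟩
  τ (role x)         ∎)
  where open ≡-Reasoning

partner-≢-self : ∀ {σ} → (∀ r → σ r ≢ r) → ∀ x → partner σ x ≢ x
partner-≢-self {σ} σ≢id x e = σ≢id (role x) (trans (≡.sym (role-partner σ x)) (cong role e))

-- Testing the gadgets of both endpoints is redundant (they coincide) but makes symmetry evident.
matching : (ℕ → Bool) → (Fin 4 → Fin 4) → ℕ → ℕ → Bool
matching active σ x y = (active (gadget x) ∧ active (gadget y)) ∧ does (y ≟ partner σ x)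

module _ (active : ℕ → Bool) (σ : Fin 4 → Fin 4) where

  matching⇒active : ∀ x y → matching active σ x y ≡ true → active (gadget x) ≡ true
  matching⇒active x y = Bool.∧-conicalˡ _ _ ∘ Bool.∧-conicalˡ _ _

  matching⇒partner : ∀ x y → matching active σ x y ≡ true → y ≡ partner σ x
  matching⇒partner x y = does⇒ (y ≟ partner σ x) ∘ Bool.∧-conicalʳ _ _

  matching-partner : ∀ x → active (gadget x) ≡ true → matching active σ x (partner σ x) ≡ true
  matching-partner x a = cong₂ _∧_
    (cong₂ _∧_ a (trans (cong active (gadget-partner σ x)) a))
    (dec-true (partner σ x ≟ partner σ x) refl)

  matching-irrefl : (∀ r → σ r ≢ r) → ∀ x → matching active σ x x ≡ false
  matching-irrefl σ≢id x = trans
    (cong ((active (gadget x) ∧ active (gadget x)) ∧_)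
          (dec-false (x ≟ partner σ x) (partner-≢-self σ≢id x ∘ ≡.sym)))
    (Bool.∧-zeroʳ _)

  matching-sym : Involutive σ → ∀ x y → matching active σ x y ≡ matching active σ y x
  matching-sym σ-inv x y = cong₂ _∧_ (Bool.∧-comm (active (gadget x)) (active (gadget y)))
    (does-⇔ (mk⇔ flip flip) (y ≟ partner σ x) (x ≟ partner σ y))
    where
    flip : ∀ {x y} → y ≡ partner σ x → x ≡ partner σ y
    flip {x} refl = ≡.sym (partner-involutive {σ} σ-inv x)

-- Roles are the cells of the grid (0 1 / 2 3); the two matchings form the 4-cycle 0-1-3-2-0.
flipColumn flipRow : Fin 4 → Fin 4
flipColumn 0F = 1F
flipColumn 1F = 0F
flipColumn 2F = 3F
flipColumn 3F = 2F
flipRow 0F = 2F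
flipRow 1F = 3F
flipRow 2F = 0F
flipRow 3F = 1F

flipColumn-involutive : Involutive flipColumn
flipColumn-involutive 0F = refl
flipColumn-involutive 1F = refl
flipColumn-involutive 2F = refl
flipColumn-involutive 3F = refl

flipRow-involutive : Involutive flipRow
flipRow-involutive 0F = refl
flipRow-involutive 1F = refl
flipRow-involutive 2F = refl
flipRow-involutive 3F = refl

flipColumn-≢-id : ∀ r → flipColumn r ≢ r
flipColumn-≢-id 0F ()
flipColumn-≢-id 1F ()
flipColumn-≢-id 2F ()
flipColumn-≢-id 3F ()

flipRow-≢-id : ∀ r → flipRow r ≢ r
flipRow-≢-id 0F ()
flipRow-≢-id 1F ()
flipRow-≢-id 2F ()
flipRow-≢-id 3F ()

flipColumn-≢-flipRow : ∀ r → flipColumn r ≢ flipRow r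
flipColumn-≢-flipRow 0F ()
flipColumn-≢-flipRow 1F ()
flipColumn-≢-flipRow 2F ()
flipColumn-≢-flipRow 3F ()

module _ {k : ℕ} where

  columnEdges rowEdges : Vec Bool k → ℕ → ℕ → Bool
  columnEdges S = matching (bitAt S) flipColumn
  rowEdges    T = matching (not ∘ bitAt T) flipRow

  column-row-disjoint : ∀ S T x y → columnEdges S x y ≡ true → rowEdges T x y ≡ true → ⊥
  column-row-disjoint S T x y c r = partner-≢ flipColumn-≢-flipRow x (trans
    (≡.sym (matching⇒partner (bitAt S) flipColumn x y c))
    (matching⇒partner (not ∘ bitAt T) flipRow x y r))

  gadgetGraph : ∀ {n} → Vec Bool k → Vec Bool k → Graph n
  gadgetGraph S T = record
    { adj    = λ u v → columnEdges S (toℕ u) (toℕ v) ∨ rowEdges T (toℕ u) (toℕ v)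
    ; sym    = λ u v → cong₂ _∨_
        (matching-sym (bitAt S) flipColumn flipColumn-involutive (toℕ u) (toℕ v))
        (matching-sym (not ∘ bitAt T) flipRow flipRow-involutive (toℕ u) (toℕ v))
    ; irrefl = λ u → cong₂ _∨_
        (matching-irrefl (bitAt S) flipColumn flipColumn-≢-id (toℕ u))
        (matching-irrefl (not ∘ bitAt T) flipRow flipRow-≢-id (toℕ u))
    }

  adjacent-columnPartner : ∀ {n} S T (u v : Fin n) → toℕ v ≡ partner flipColumn (toℕ u) →
    bitAt S (gadget (toℕ u)) ≡ true → adj (gadgetGraph S T) u v ≡ true
  adjacent-columnPartner S T u v v≡ Sᵤ rewrite v≡ =
    cong (_∨ _) (matching-partner (bitAt S) flipColumn (toℕ u) Sᵤ)

  adjacent-rowPartner : ∀ {n} S T (u v : Fin n) → toℕ v ≡ partner flipRow (toℕ u) →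
    bitAt T (gadget (toℕ u)) ≡ false → adj (gadgetGraph S T) u v ≡ true
  adjacent-rowPartner S T u v v≡ Tᵤ rewrite v≡ =
    trans (cong (_ ∨_) (matching-partner (not ∘ bitAt T) flipRow (toℕ u) (cong not Tᵤ)))
          (Bool.∨-zeroʳ _)

  gadgetGraph-diagonal-Degeneracy≤1 : ∀ {n} (S : Vec Bool k) → Degeneracy≤1 (gadgetGraph {n} S S)
  gadgetGraph-diagonal-Degeneracy≤1 S = atMostOneNeighbour⇒Degeneracy≤1 _ λ v w₁ w₂ e₁ e₂ →
    Fin.toℕ-injective (unique (toℕ v) (toℕ w₁) (toℕ w₂) (∨-true e₁) (∨-true e₂))
    where
    column⇒partner : ∀ x y → columnEdges S x y ≡ true → y ≡ partner flipColumn x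
    column⇒partner = matching⇒partner (bitAt S) flipColumn
    row⇒partner : ∀ x y → rowEdges S x y ≡ true → y ≡ partner flipRow x
    row⇒partner = matching⇒partner (not ∘ bitAt S) flipRow
    clash : ∀ x y z → columnEdges S x y ≡ true → rowEdges S x z ≡ true → ⊥
    clash x y z c r with () ← trans (≡.sym (cong not (matching⇒active (bitAt S) flipColumn x y c)))
                                    (matching⇒active (not ∘ bitAt S) flipRow x z r)
    unique : ∀ x y z → columnEdges S x y ≡ true ⊎ rowEdges S x y ≡ true →
             columnEdges S x z ≡ true ⊎ rowEdges S x z ≡ true → y ≡ z
    unique x y z (inj₁ c₁) (inj₁ c₂) =
      trans (column⇒partner x y c₁) (≡.sym (column⇒partner x z c₂))
    unique x y z (inj₂ r₁) (inj₂ r₂) =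
      trans (row⇒partner x y r₁) (≡.sym (row⇒partner x z r₂))
    unique x y z (inj₁ c)  (inj₂ r)  = ⊥-elim (clash x y z c r)
    unique x y z (inj₂ r)  (inj₁ c)  = ⊥-elim (clash x z y c r)

  gadgetGraph-¬Degeneracy≤1 : ∀ {n} (S T : Vec Bool k) {i} → k * 4 ≤ n →
    bitAt S i ≡ true → bitAt T i ≡ false → ¬ Degeneracy≤1 (gadgetGraph {n} S T)
  gadgetGraph-¬Degeneracy≤1 {n} S T {i} k*4≤n Sᵢ Tᵢ = minDegree≥2⇒¬Degeneracy≤1 _ inGadget
    (vertex (join (i , 0F)) g₀ , vertex-inGadget (join (i , 0F)) g₀) twoNeighbours
    where
    g₀ = cong proj₁ (split-join (i , 0F))

    inGadget : Fin n → Bool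
    inGadget u = does (gadget (toℕ u) ≟ i)

    vertex : ∀ y → gadget y ≡ i → Fin n
    vertex y g = fromℕ< (ℕ.<-≤-trans (gadget<⇒< y (subst (_< k) (≡.sym g) i<k)) k*4≤n)
      where i<k = bitAt-true⇒< S Sᵢ

    toℕ-vertex : ∀ y g → toℕ (vertex y g) ≡ y
    toℕ-vertex y g = Fin.toℕ-fromℕ< _

    vertex-inGadget : ∀ y g → inGadget (vertex y g) ≡ true
    vertex-inGadget y g = dec-true (_ ≟ i) (trans (cong gadget (toℕ-vertex y g)) g)

    twoNeighbours : ∀ v → inGadget v ≡ true → TwoNeighboursIn (gadgetGraph S T) inGadget v
    twoNeighbours v v∈ =
      neighbour flipColumn , neighbour flipRow ,
      (λ e → partner-≢ flipColumn-≢-flipRow x (trans (≡.sym (toℕ-neighbour flipColumn))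
                                                   (trans (cong toℕ e) (toℕ-neighbour flipRow)))) ,
      (vertex-inGadget (partner flipColumn x) (g-partner flipColumn) ,
       adjacent-columnPartner S T v _ (toℕ-neighbour flipColumn) (trans (cong (bitAt S) g) Sᵢ)) ,
      (vertex-inGadget (partner flipRow x) (g-partner flipRow) ,
       adjacent-rowPartner S T v _ (toℕ-neighbour flipRow) (trans (cong (bitAt T) g) Tᵢ))
      where
      x = toℕ v
      g : gadget x ≡ i
      g = does⇒ (gadget x ≟ i) v∈
      g-partner : ∀ σ → gadget (partner σ x) ≡ i
      g-partner σ = trans (gadget-partner σ x) g
      neighbour : (Fin 4 → Fin 4) → Fin n
      neighbour σ = vertex (partner σ x) (g-partner σ)
      toℕ-neighbour : ∀ σ → toℕ (neighbour σ) ≡ partner σ x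
      toℕ-neighbour σ = toℕ-vertex (partner σ x) (g-partner σ)

-- The fooling set

module _ {n c m : ℕ} (𝒮 : Scheme n c m) where

  stateAfter : Certificate → List (Fin n × Fin n) → Vec Bool m
  stateAfter cert = foldl (step 𝒮 cert) (init 𝒮 cert)

  run-splice : ∀ {cert₁ cert₂} s₁ s₂ t → cert₁ ≡ cert₂ →
               stateAfter cert₁ s₁ ≡ stateAfter cert₂ s₂ →
               run 𝒮 cert₁ (s₁ ++ t) ≡ run 𝒮 cert₂ (s₂ ++ t)
  run-splice {cert} s₁ s₂ t refl eq = begin
    run 𝒮 cert (s₁ ++ t)
      ≡⟨ cong (decide 𝒮 cert) (List.foldl-++ (step 𝒮 cert) _ s₁ t) ⟩
    decide 𝒮 cert (foldl (step 𝒮 cert) (stateAfter cert s₁) t)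
      ≡⟨ cong (λ σ → decide 𝒮 cert (foldl (step 𝒮 cert) σ t)) eq ⟩
    decide 𝒮 cert (foldl (step 𝒮 cert) (stateAfter cert s₂) t)
      ≡⟨ cong (decide 𝒮 cert) (List.foldl-++ (step 𝒮 cert) _ s₂ t) ⟨
    run 𝒮 cert (s₂ ++ t) ∎
    where open ≡-Reasoning

module FoolingSet {n c m : ℕ} (𝒮 : Scheme n c m) where

  k : ℕ
  k = gadget n

  k*4≤n : k * 4 ≤ n
  k*4≤n = subst (k * 4 ≤_) (join-split n) (ℕ.m≤m+n (k * 4) _)

  columnStream rowStream : Vec Bool k → List (Fin n × Fin n)
  columnStream S = edgeList λ u v → columnEdges S (toℕ u) (toℕ v)
  rowStream    T = edgeList λ u v → rowEdges T (toℕ u) (toℕ v)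

  stream-IsStream : ∀ S T → IsStream (gadgetGraph S T) (columnStream S ++ rowStream T)
  stream-IsStream S T = edgeList-++-IsStream (gadgetGraph S T) _ _ (λ _ _ → refl)
    (λ u v → column-row-disjoint S T (toℕ u) (toℕ v))

  certificate : Vec Bool k → Certificate
  certificate S = prover 𝒮 (gadgetGraph S S)

  fingerprint : Vec Bool k → Vec Bool (suc c + m)
  fingerprint S =
    padWithSentinel c (certificate S) Vec.++ stateAfter 𝒮 (certificate S) (columnStream S)

  spliced-accepted : ∀ S T → fingerprint S ≡ fingerprint T →
                     run 𝒮 (certificate S) (columnStream S ++ rowStream T) ≡ true
  spliced-accepted S T eq = begin
    run 𝒮 (certificate S) (columnStream S ++ rowStream T)
      ≡⟨ run-splice 𝒮 (columnStream S) (columnStream T) (rowStream T) same-certificate same-state ⟩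
    run 𝒮 (certificate T) (columnStream T ++ rowStream T)
      ≡⟨ completeness 𝒮 _ (gadgetGraph-diagonal-Degeneracy≤1 T) _ (stream-IsStream T T) ⟩
    true ∎
    where
    open ≡-Reasoning
    same-certificate : certificate S ≡ certificate T
    same-certificate = padWithSentinel-injective c (proverLen 𝒮 _) (proverLen 𝒮 _)
      (Vec.++-injectiveˡ (padWithSentinel c (certificate S)) _ eq)
    same-state : stateAfter 𝒮 (certificate S) (columnStream S)
               ≡ stateAfter 𝒮 (certificate T) (columnStream T)
    same-state = Vec.++-injectiveʳ (padWithSentinel c (certificate S)) _ eq

  spliced-rejected : ∀ S T {i} → bitAt S i ≡ true → bitAt T i ≡ false →
                     run 𝒮 (certificate S) (columnStream S ++ rowStream T) ≡ false
  spliced-rejected S T Sᵢ Tᵢ =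
    soundness 𝒮 _ (gadgetGraph-¬Degeneracy≤1 S T k*4≤n Sᵢ Tᵢ) _ _ (stream-IsStream S T)

  fooled : ∀ S T {i} → bitAt S i ≡ true → bitAt T i ≡ false → fingerprint S ≢ fingerprint T
  fooled S T Sᵢ Tᵢ eq =
    contradiction (trans (≡.sym (spliced-accepted S T eq)) (spliced-rejected S T Sᵢ Tᵢ)) λ ()

  fingerprint-injective : Injective _≡_ _≡_ fingerprint
  fingerprint-injective {S} {T} eq = bitAt-injective same-bit
    where
    same-bit : ∀ i → bitAt S i ≡ bitAt T i
    same-bit i with bitAt S i in Sᵢ | bitAt T i in Tᵢ
    ... | true  | true  = refl
    ... | false | false = refl
    ... | true  | false = ⊥-elim (fooled S T Sᵢ Tᵢ eq)
    ... | false | true  = ⊥-elim (fooled T S Tᵢ Sᵢ (≡.sym eq))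

  gadgets≤memory : k ≤ suc c + m
  gadgets≤memory = bitVector-pigeonhole fingerprint fingerprint-injective

n≤gadget*4+3 : ∀ n → n ≤ gadget n * 4 + 3
n≤gadget*4+3 n = subst (_≤ gadget n * 4 + 3) (join-split n)
  (ℕ.+-monoʳ-≤ (gadget n * 4) (ℕ.≤-pred (Fin.toℕ<n (role n))))

gadgets≤1+s⇒n≤11s : ∀ {n} s → 8 ≤ n → gadget n ≤ suc s → n ≤ 11 * s
gadgets≤1+s⇒n≤11s {n} s 8≤n g≤ =
  bound s (ℕ.≤-trans (n≤gadget*4+3 n) (ℕ.+-monoˡ-≤ 3 (ℕ.*-monoˡ-≤ 4 g≤)))
  where
  bound : ∀ s → n ≤ suc s * 4 + 3 → n ≤ 11 * s
  bound zero    n≤7 = contradiction (ℕ.≤-trans 8≤n n≤7) (ℕ.<-irrefl refl)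
  bound (suc t) n≤  = begin
    n               ≤⟨ n≤ ⟩
    8 + (t * 4 + 3) ≡⟨ cong (8 +_) (ℕ.+-comm (t * 4) 3) ⟩
    11 + t * 4      ≤⟨ ℕ.+-monoʳ-≤ 11 (ℕ.*-monoʳ-≤ t (ℕ.m≤m+n 4 7)) ⟩
    11 + t * 11     ≡⟨ ℕ.*-comm (suc t) 11 ⟩
    11 * suc t      ∎
    where open ℕ.≤-Reasoning

theorem11 : ∃ λ (K : ℕ) → ∃ λ (N : ℕ) → ∀ (n c m : ℕ) → N ≤ n →
    Scheme n c m → n ≤ K * (c + m)
theorem11 = 11 , 8 , λ n c m 8≤n 𝒮 →
  gadgets≤1+s⇒n≤11s (c + m) 8≤n (FoolingSet.gadgets≤memory 𝒮)
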